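{- Let $k \geqslant 1$, let $T(k)$ be the rooted tree with root $r$ and labeling $\varphi_k : V(T(k))\setminus\{r\} \to [k]$ defined below, and (for $k>1$) let $B_1, B_2$ be the two attached subtrees defined below. 1. If $L$ is the set of leaves of $T(k)$, then $\varphi_k(L \cap V(B_1)) = \{\lceil k/2\rceil + 1, \dots, k\}$ and $\varphi_k(L \cap V(B_2)) = \{1, \dots, \lceil k/2\rceil\}$. 2. For every leaf $\lambda$ of $T(k)$, $\varphi_k(V(P(\lambda)) \setminus \{r\}) = [k]$, where $P(\lambda)$ is the path in $T(k)$ from $r$ to $\lambda$. 3. Each label $i \in [k]$ occurs at most $\lceil \log k \rceil + 1$ times in the labeling $\varphi_k$ of $T(k)$.
   Context: The length of a path is its number of edges. The tree $T(k)$ is defined recursively. $T(1)$ consists of a root $r$ and a single leaf attached to it. For $k>1$, set $k_1 = \lceil k/2 \rceil$ and $k_2 = \lfloor k/2 \rfloor$; take a path $P_1$ of length $k_1$ and a path $P_2$ of length $k_2$ sharing one endpoint, the root $r$; let $\lambda_i$ be the endpoint of $P_i$ other than $r$; then attach a copy of $T(k_i)$ to $\lambda_{3-i}$, identifying $\lambda_{3-i}$ with the root of that copy. Let $B_i$ denote the copy attached at $\lambda_i$, so $B_i$ is a copy of $T(k_{3-i})$ and $V(T(k)) = \bigcup_{i=1,2}(V(P_i) \cup V(B_i))$. The labeling $\varphi_k$ is defined recursively: for $k=1$, the non-root vertex gets label $1$. For $k>1$, name the vertices of $P_1$ in order as $r, v_1, \dots, v_{k_1}$ and those of $P_2$ in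 order as $r, v_{k_1+1}, \dots, v_k$; then $\varphi_k(v_i) = i$, $\varphi_k(v) = \varphi_{k_2}(v) + k_1$ for $v \in V(B_1)\setminus V(P_1)$, and $\varphi_k(v) = \varphi_{k_1}(v)$ for $v \in V(B_2) \setminus V(P_2)$ (using the labelings of the copies of $T(k_2)$ and $T(k_1)$ respectively). -}

module Defs where

open import Data.Nat using (ℕ; zero; suc; _+_; _∸_; ⌈_/2⌉; ⌊_/2⌋)
open import Data.List using (List; []; _∷_; _++_; [_]; length; lookup; replicate)
open import Data.Fin using (Fin; toℕ)
open import Data.Product using (_×_; _,_; proj₁; proj₂; ∃)
open import Data.Maybe using (Maybe; just; nothing; _<∣>_)
open import Relation.Binary.PropositionalEquality using (_≡_)

-- A node is the ordered list of its children; each child is given as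
-- (label of the child vertex , subtree rooted at the child).
data Tree : Set where
  node : List (ℕ × Tree) → Tree

children : Tree → List (ℕ × Tree)
children (node cs) = cs

data Pos : Tree → Set where
  root  : {t : Tree} → Pos t
  child : {cs : List (ℕ × Tree)} (i : Fin (length cs)) →
          Pos (proj₂ (lookup cs i)) → Pos (node cs)

label : {t : Tree} → Pos t → Maybe ℕ
label root = nothing
label {node cs} (child i p) = label p <∣> just (proj₁ (lookup cs i))

sub : {t : Tree} → Pos t → Tree
sub {t} root = t
sub (child i p) = sub p

Leaf : {t : Tree} → Pos t → Set
Leaf p = children (sub p) ≡ []

addr : {t : Tree} → Pos t → List ℕ
addr root = []
addr (child i p) = toℕ i ∷ addr p

-- q lies on the path from the root to v (q is an ancestor of v or v itself).
_≼_ : {t : Tree} → Pos t → Pos t → Set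
q ≼ v = ∃ λ rest → addr v ≡ addr q ++ rest

mutual
  shift : ℕ → Tree → Tree
  shift a (node cs) = node (shiftL a cs)

  shiftL : ℕ → List (ℕ × Tree) → List (ℕ × Tree)
  shiftL a [] = []
  shiftL a ((l , t) ∷ cs) = (l + a , shift a t) ∷ shiftL a cs

-- range a m = [a+1, …, a+m]
range : ℕ → ℕ → List ℕ
range a zero = []
range a (suc m) = suc a ∷ range (suc a) m

-- chain [l₁,…,lₘ] cs : a path hanging from the current vertex with vertices
-- labelled l₁,…,lₘ, whose last vertex λ gets the children cs
-- (this identifies λ with the root of a tree whose root children are cs).
chain : List ℕ → List (ℕ × Tree) → List (ℕ × Tree)
chain [] cs = cs
chain (l ∷ ls) cs = [ (l , node (chain ls cs)) ]

-- The construction of T(k) with labelling φ_k, using a fuel argument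
-- (fuel ≥ k suffices, since ⌈k/2⌉ ≤ k - 1 for k ≥ 2).
-- Children of the root: first the path P₁ (labels 1..k₁) ending in λ₁ carrying
-- a copy B₁ of T(k₂) with labels shifted by k₁, then the path P₂
-- (labels k₁+1..k) ending in λ₂ carrying a copy B₂ of T(k₁).
T′ : ℕ → ℕ → Tree
T′ zero k = node []
T′ (suc f) zero = node []
T′ (suc f) (suc zero) = node [ (1 , node []) ]
T′ (suc f) (suc (suc n)) =
  node (chain (range 0 k₁) (children (shift k₁ (T′ f k₂)))
        ++ chain (range k₁ k₂) (children (T′ f k₁)))
  where
  k₁ = ⌈ suc (suc n) /2⌉
  k₂ = ⌊ suc (suc n) /2⌋

T : ℕ → Tree
T k = T′ k k

λ₁addr : ℕ → List ℕ
λ₁addr k = replicate ⌈ k /2⌉ 0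

λ₂addr : ℕ → List ℕ
λ₂addr k = 1 ∷ replicate (⌊ k /2⌋ ∸ 1) 0

InB₁ : (k : ℕ) → Pos (T k) → Set
InB₁ k v = ∃ λ rest → addr v ≡ λ₁addr k ++ rest

InB₂ : (k : ℕ) → Pos (T k) → Set
InB₂ k v = ∃ λ rest → addr v ≡ λ₂addr k ++ rest

-- For k ≥ 2, T(k) is the root with two paths P₁, P₂ carrying the labels 1…k₁ and k₁+1…k, below
-- whose ends hang B₁, a copy of T(k₂) with labels shifted by k₁, and B₂, a copy of T(k₁).  Leaves
-- and labels are traded for two lists that can be computed along this decomposition: the
-- root-to-leaf branches (address and labels of each path) and the list of all labels.  A branch
-- through B₁ reads 1…k₁ followed by a branch of T(k₂) shifted by k₁, one through B₂ reads k₁+1…k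
-- followed by a branch of T(k₁); so by induction every branch carries exactly the labels [k], and
-- the leaves of B₁ and B₂ carry k₁+1…k and 1…k₁.  A label occurs once on P₁ ∪ P₂ and in at most
-- one of B₁, B₂, so it occurs at most 1 + (⌈log₂ k₁⌉ + 1) = ⌈log₂ k⌉ + 1 times.

module Submission where

open import Algebra.Bundles using (CommutativeMonoid)
open import Data.Fin using (Fin; zero; suc; toℕ)
open import Data.Fin.Properties using (toℕ-injective)
open import Data.List using (List; []; _∷_; _++_; [_]; length; lookup; replicate; map; filter; last; fromMaybe; partitionSums)
open import Data.List.Membership.Propositional using (_∈_; _∉_)
open import Data.List.Membership.Propositional.Properties using (∈-map⁺; ∈-map⁻; ∈-++⁺ˡ; ∈-++⁺ʳ; ∈-++⁻)
open import Data.List.Properties using (length-map; length-++; map-id; map-∘; map-++; ++-assoc; ++-identityʳ; ∷-injectiveˡ; ∷-injectiveʳ; filter-++; filter-accept; filter-reject; filter-none; last-map)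
import Data.List.Properties as List
open import Data.List.Relation.Binary.BagAndSetEquality using (_∼[_]_; set; [_]-Equality; map-cong; ++-cong; ++-idempotent; commutativeMonoid)
open import Data.List.Relation.Binary.Subset.Propositional using (_⊆_)
import Data.List.Relation.Binary.Subset.Propositional.Properties as ⊆
open import Data.List.Relation.Unary.All as All using (All; []; _∷_)
open import Data.List.Relation.Unary.All.Properties using (all-filter; ¬Any⇒All¬; ++⁺) renaming (map⁺ to All-map⁺)
open import Data.List.Relation.Unary.AllPairs using ([]; _∷_)
open import Data.List.Relation.Unary.Any using (here; there)
open import Data.List.Relation.Unary.Unique.Propositional using (Unique)
import Data.List.Relation.Unary.Unique.Propositional.Properties as Unique
open import Data.Maybe using (Maybe; just; nothing; _<∣>_)
import Data.Maybe as Maybe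
open import Data.Maybe.Properties using (<∣>-assoc; <∣>-identityʳ)
open import Data.Nat using (ℕ; zero; suc; _+_; _∸_; _≤_; _<_; z≤n; s≤s; s≤s⁻¹; _≟_; _≤?_; ⌈_/2⌉; ⌊_/2⌋)
open import Data.Nat.Induction using (<-rec)
open import Data.Nat.Logarithm using (⌈log₂_⌉; ⌈log₂⌉-mono-≤; ⌈log₂⌈n/2⌉⌉≡⌈log₂n⌉∸1)
open import Data.Nat.Properties
open import Algebra.Properties.CommutativeSemigroup +-commutativeSemigroup using (x∙yz≈y∙xz; interchange)
open import Data.Product using (_×_; _,_; proj₁; proj₂; ∃)
open import Data.Sum using (_⊎_; inj₁; inj₂; [_,_]′)
open import Data.Sum.Properties using (inj₁-injective; inj₂-injective)
open import Function using (_∘_; _⇔_; mk⇔; Equivalence)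
open import Function.Properties.Equivalence using () renaming (trans to ⇔-trans)
open import Function.Related.Propositional using (SymmetricKind)
open import Relation.Binary.Bundles using (Setoid)
open import Relation.Binary.PropositionalEquality hiding ([_])
import Relation.Binary.Reasoning.Setoid as SetoidReasoning
open import Relation.Nullary using (Dec; yes; no; contradiction)

open import Defs

module _ {A : Set} where

  last-∷ : ∀ (x : A) xs → last (x ∷ xs) ≡ last xs <∣> just x
  last-∷ x [] = refl
  last-∷ x (y ∷ ys) = begin
    last (y ∷ ys)                   ≡⟨ last-∷ y ys ⟩
    last ys <∣> just y              ≡⟨ <∣>-assoc (last ys) (just y) (just x) ⟨
    (last ys <∣> just y) <∣> just x ≡⟨ cong (_<∣> just x) (last-∷ y ys) ⟨
    last (y ∷ ys) <∣> just x        ∎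
    where open ≡-Reasoning

  last-++ : ∀ (xs ys : List A) → last (xs ++ ys) ≡ last ys <∣> last xs
  last-++ [] ys = sym (<∣>-identityʳ (last ys))
  last-++ (x ∷ xs) ys = begin
    last (x ∷ xs ++ ys)              ≡⟨ last-∷ x (xs ++ ys) ⟩
    last (xs ++ ys) <∣> just x       ≡⟨ cong (_<∣> just x) (last-++ xs ys) ⟩
    (last ys <∣> last xs) <∣> just x ≡⟨ <∣>-assoc (last ys) (last xs) (just x) ⟩
    last ys <∣> (last xs <∣> just x) ≡⟨ cong (last ys <∣>_) (last-∷ x xs) ⟨
    last ys <∣> last (x ∷ xs)        ∎
    where open ≡-Reasoning

  <∣>-just⁻ : ∀ (m : Maybe A) {x y} → m <∣> just y ≡ just x → (m ≡ nothing × y ≡ x) ⊎ m ≡ just x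
  <∣>-just⁻ nothing refl = inj₁ (refl , refl)
  <∣>-just⁻ (just _) refl = inj₂ refl

  just∈map-just⇔ : ∀ {x : A} {xs} → just x ∈ map just xs ⇔ x ∈ xs
  just∈map-just⇔ = mk⇔ from-map (∈-map⁺ just)
    where
    from-map : ∀ {x xs} → just x ∈ map just xs → x ∈ xs
    from-map jx∈ with ∈-map⁻ just jx∈
    ... | _ , y∈ , refl = y∈

module ∼-Reasoning {A : Set} = SetoidReasoning ([ SymmetricKind.equivalence ]-Equality A)
module ∼ {A : Set} = Setoid ([ SymmetricKind.equivalence ]-Equality A)

++-comm-∼ : ∀ {A : Set} (xs ys : List A) → xs ++ ys ∼[ set ] ys ++ xs
++-comm-∼ {A} = CommutativeMonoid.comm (commutativeMonoid SymmetricKind.equivalence A)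

module _ {A B : Set} where

  length-partitionSums : (zs : List (A ⊎ B)) →
    length zs ≡ length (proj₁ (partitionSums zs)) + length (proj₂ (partitionSums zs))
  length-partitionSums [] = refl
  length-partitionSums (inj₁ a ∷ zs) = cong suc (length-partitionSums zs)
  length-partitionSums (inj₂ b ∷ zs) = trans (cong suc (length-partitionSums zs)) (sym (+-suc _ _))

  All-partitionSums : ∀ {P : A → Set} {Q : B → Set} {zs : List (A ⊎ B)} → All [ P , Q ]′ zs →
    All P (proj₁ (partitionSums zs)) × All Q (proj₂ (partitionSums zs))
  All-partitionSums [] = [] , []
  All-partitionSums {zs = inj₁ a ∷ zs} (pa ∷ pzs) = let (ps , qs) = All-partitionSums pzs in pa ∷ ps , qs
  All-partitionSums {zs = inj₂ b ∷ zs} (qb ∷ pzs) = let (ps , qs) = All-partitionSums pzs in ps , qb ∷ qs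

  ∈-partitionSums₁ : ∀ {a} {zs : List (A ⊎ B)} → a ∈ proj₁ (partitionSums zs) → inj₁ a ∈ zs
  ∈-partitionSums₁ {zs = inj₁ a ∷ zs} (here refl) = here refl
  ∈-partitionSums₁ {zs = inj₁ a ∷ zs} (there a∈) = there (∈-partitionSums₁ a∈)
  ∈-partitionSums₁ {zs = inj₂ b ∷ zs} a∈ = there (∈-partitionSums₁ a∈)

  ∈-partitionSums₂ : ∀ {b} {zs : List (A ⊎ B)} → b ∈ proj₂ (partitionSums zs) → inj₂ b ∈ zs
  ∈-partitionSums₂ {zs = inj₂ b ∷ zs} (here refl) = here refl
  ∈-partitionSums₂ {zs = inj₂ b ∷ zs} (there b∈) = there (∈-partitionSums₂ b∈)
  ∈-partitionSums₂ {zs = inj₁ a ∷ zs} b∈ = there (∈-partitionSums₂ b∈)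

  Unique-partitionSums : ∀ {zs : List (A ⊎ B)} → Unique zs →
    Unique (proj₁ (partitionSums zs)) × Unique (proj₂ (partitionSums zs))
  Unique-partitionSums [] = [] , []
  Unique-partitionSums {inj₁ a ∷ zs} (a∉ ∷ u) = let (u₁ , u₂) = Unique-partitionSums u in
    All.tabulate (λ x∈ a≡x → All.lookup a∉ (∈-partitionSums₁ x∈) (cong inj₁ a≡x)) ∷ u₁ , u₂
  Unique-partitionSums {inj₂ b ∷ zs} (b∉ ∷ u) = let (u₁ , u₂) = Unique-partitionSums u in
    u₁ , All.tabulate (λ x∈ b≡x → All.lookup b∉ (∈-partitionSums₂ x∈) (cong inj₂ b≡x)) ∷ u₂

count : ℕ → List ℕ → ℕ
count i xs = length (filter (i ≟_) xs)

count-++ : ∀ i xs ys → count i (xs ++ ys) ≡ count i xs + count i ys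
count-++ i xs ys = trans (cong length (filter-++ (i ≟_) xs ys)) (length-++ (filter (i ≟_) xs))

count-here : ∀ i xs → count i (i ∷ xs) ≡ suc (count i xs)
count-here i xs = cong length (filter-accept (i ≟_) refl)

count-there : ∀ {i x} xs → i ≢ x → count i (x ∷ xs) ≡ count i xs
count-there xs i≢x = cong length (filter-reject (_ ≟_) i≢x)

count-map-+ : ∀ a j xs → count (j + a) (map (_+ a) xs) ≡ count j xs
count-map-+ a j [] = refl
count-map-+ a j (x ∷ xs) = by-cases (j ≟ x)
  where
  by-cases : Dec (j ≡ x) → count (j + a) (x + a ∷ map (_+ a) xs) ≡ count j (x ∷ xs)
  by-cases (yes refl) =
    trans (count-here (j + a) _) (trans (cong suc (count-map-+ a j xs)) (sym (count-here j xs)))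
  by-cases (no j≢x) =
    trans (count-there _ (j≢x ∘ +-cancelʳ-≡ a j x)) (trans (count-map-+ a j xs) (sym (count-there xs j≢x)))

∉⇒count≡0 : ∀ {i xs} → i ∉ xs → count i xs ≡ 0
∉⇒count≡0 {i} {xs} i∉xs = cong length (filter-none (i ≟_) (¬Any⇒All¬ xs i∉xs))

count-unique : ∀ i {xs} → Unique xs → count i xs ≤ 1
count-unique i {xs} u = singleton-like (Unique.filter⁺ (i ≟_) u) (all-filter (i ≟_) xs)
  where
  singleton-like : ∀ {ys} → Unique ys → All (i ≡_) ys → length ys ≤ 1
  singleton-like [] _ = z≤n
  singleton-like (_ ∷ []) _ = s≤s z≤n
  singleton-like ((y≢z ∷ _) ∷ _) (refl ∷ refl ∷ _) = contradiction refl y≢z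

∈-range⇔ : ∀ a m {x} → x ∈ range a m ⇔ (a < x × x ≤ a + m)
∈-range⇔ a zero {x} =
  mk⇔ (λ ()) λ (a<x , x≤a+0) → contradiction (≤-trans x≤a+0 (≤-reflexive (+-identityʳ a))) (<⇒≱ a<x)
∈-range⇔ a (suc m) {x} = mk⇔ to from
  where
  a+1+m≡ : a + suc m ≡ suc (a + m)
  a+1+m≡ = +-suc a m
  to : x ∈ range a (suc m) → a < x × x ≤ a + suc m
  to (here refl) = ≤-refl , ≤-trans (s≤s (m≤m+n a m)) (≤-reflexive (sym a+1+m≡))
  to (there x∈) with Equivalence.to (∈-range⇔ (suc a) m) x∈
  ... | 1+a<x , x≤ = <⇒≤ 1+a<x , ≤-trans x≤ (≤-reflexive (sym a+1+m≡))
  from : a < x × x ≤ a + suc m → x ∈ range a (suc m)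
  from (a<x , x≤) with suc a ≟ x
  ... | yes refl = here refl
  ... | no 1+a≢x =
    there (Equivalence.from (∈-range⇔ (suc a) m) (≤∧≢⇒< a<x 1+a≢x , ≤-trans x≤ (≤-reflexive a+1+m≡)))

map-+-range : ∀ b a m → map (_+ b) (range a m) ≡ range (a + b) m
map-+-range b a zero = refl
map-+-range b a (suc m) = cong (suc (a + b) ∷_) (map-+-range b (suc a) m)

range-++ : ∀ a m n → range a m ++ range (a + m) n ≡ range a (m + n)
range-++ a zero n = cong (λ b → range b n) (+-identityʳ a)
range-++ a (suc m) n =
  cong (suc a ∷_) (trans (cong (λ b → range (suc a) m ++ range b n) (+-suc a m)) (range-++ (suc a) m n))

length-range : ∀ a m → length (range a m) ≡ m
length-range a zero = refl
length-range a (suc m) = cong suc (length-range (suc a) m)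

range-unique : ∀ a m → Unique (range a m)
range-unique a zero = []
range-unique a (suc m) =
  All.tabulate (λ x∈ → <⇒≢ (proj₁ (Equivalence.to (∈-range⇔ (suc a) m) x∈))) ∷ range-unique (suc a) m

pathLabels : {t : Tree} → Pos t → List ℕ
pathLabels root = []
pathLabels {node cs} (child i p) = proj₁ (lookup cs i) ∷ pathLabels p

label≡last-pathLabels : {t : Tree} (v : Pos t) → label v ≡ last (pathLabels v)
label≡last-pathLabels root = refl
label≡last-pathLabels {node cs} (child i p) =
  trans (cong (_<∣> just _) (label≡last-pathLabels p)) (sym (last-∷ _ (pathLabels p)))

ancestorLabel⇔∈pathLabels : {t : Tree} (v : Pos t) {l : ℕ} →
  (∃ λ q → q ≼ v × label q ≡ just l) ⇔ l ∈ pathLabels v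
ancestorLabel⇔∈pathLabels v = mk⇔ (λ (q , q≼v , lab) → to v q q≼v lab) (from v)
  where
  to : ∀ {t l} (v q : Pos t) → q ≼ v → label q ≡ just l → l ∈ pathLabels v
  to v root _ ()
  to root (child j q) (_ , ())
  to (child i p) (child j q) (rest , e) lab with toℕ-injective (∷-injectiveˡ e)
  ... | refl with <∣>-just⁻ (label q) lab
  ...   | inj₁ (_ , refl) = here refl
  ...   | inj₂ lab′ = there (to p q (rest , ∷-injectiveʳ e) lab′)

  from : ∀ {t l} (v : Pos t) → l ∈ pathLabels v → ∃ λ q → q ≼ v × label q ≡ just l
  from (child i p) (here refl) = child i root , (addr p , refl) , refl
  from (child i p) (there l∈) with from p l∈
  ... | q , (rest , e) , lab = child i q , (rest , cong (toℕ i ∷_) e) , cong (_<∣> just _) lab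

-- A root-to-leaf path: the address of its leaf and the labels along it, from the root down.
Branch : Set
Branch = List ℕ × List ℕ

branchAt : {t : Tree} → Pos t → Branch
branchAt v = addr v , pathLabels v

leafLabel : Branch → Maybe ℕ
leafLabel = last ∘ proj₂

extend : List ℕ → List ℕ → Branch → Branch
extend as ls (bs , ms) = as ++ bs , ls ++ ms

mutual
  branches : Tree → List Branch
  branches (node []) = [ [] , [] ]
  branches (node (c ∷ cs)) = branchesFrom 0 (c ∷ cs)

  -- n is the child index of the first tree in the list.
  branchesFrom : ℕ → List (ℕ × Tree) → List Branch
  branchesFrom n [] = []
  branchesFrom n ((l , t) ∷ cs) = map (extend [ n ] [ l ]) (branches t) ++ branchesFrom (suc n) cs

∈-branchesFrom : ∀ n cs (i : Fin (length cs)) {b} → b ∈ branches (proj₂ (lookup cs i)) →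
  extend [ n + toℕ i ] [ proj₁ (lookup cs i) ] b ∈ branchesFrom n cs
∈-branchesFrom n ((l , t) ∷ cs) zero {b} b∈ =
  subst (λ k → extend [ k ] [ l ] b ∈ branchesFrom n ((l , t) ∷ cs)) (sym (+-identityʳ n))
    (∈-++⁺ˡ (∈-map⁺ _ b∈))
∈-branchesFrom n ((l , t) ∷ cs) (suc i) {b} b∈ =
  subst (λ k → extend [ k ] [ proj₁ (lookup cs i) ] b ∈ branchesFrom n ((l , t) ∷ cs)) (sym (+-suc n (toℕ i)))
    (∈-++⁺ʳ _ (∈-branchesFrom (suc n) cs i b∈))

branchAt∈branches : {t : Tree} (v : Pos t) → Leaf v → branchAt v ∈ branches t
branchAt∈branches {node []} root _ = here refl
branchAt∈branches {node (_ ∷ _)} root ()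
branchAt∈branches {node (c ∷ cs)} (child i p) leaf =
  ∈-branchesFrom 0 (c ∷ cs) i (branchAt∈branches p leaf)

mutual
  ∈-branches⇒leaf : {t : Tree} {b : Branch} → b ∈ branches t → ∃ λ (v : Pos t) → Leaf v × branchAt v ≡ b
  ∈-branches⇒leaf {node []} (here refl) = root , refl , refl
  ∈-branches⇒leaf {node (c ∷ cs)} b∈ with ∈-branchesFrom⇒leaf 0 (c ∷ cs) b∈
  ... | i , p , leaf , e = child i p , leaf , e

  ∈-branchesFrom⇒leaf : ∀ n cs {b} → b ∈ branchesFrom n cs →
    ∃ λ i → ∃ λ (p : Pos (proj₂ (lookup cs i))) →
      Leaf p × extend [ n + toℕ i ] [ proj₁ (lookup cs i) ] (branchAt p) ≡ b
  ∈-branchesFrom⇒leaf n ((l , t) ∷ cs) b∈ with ∈-++⁻ (map (extend [ n ] [ l ]) (branches t)) b∈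
  ... | inj₁ b∈t with ∈-map⁻ (extend [ n ] [ l ]) b∈t
  ...   | b′ , b′∈ , refl with ∈-branches⇒leaf {t} b′∈
  ...     | p , leaf , refl = zero , p , leaf , cong (λ k → extend [ k ] [ l ] (branchAt p)) (+-identityʳ n)
  ∈-branchesFrom⇒leaf n ((l , t) ∷ cs) b∈ | inj₂ b∈cs with ∈-branchesFrom⇒leaf (suc n) cs b∈cs
  ... | i , p , leaf , e =
    suc i , p , leaf , trans (cong (λ k → extend [ k ] [ proj₁ (lookup cs i) ] (branchAt p)) (+-suc n (toℕ i))) e

-- InB₁ k v and InB₂ k v unfold to Below (λ₁addr k) (branchAt v) and Below (λ₂addr k) (branchAt v).
Below : List ℕ → Branch → Set
Below as b = ∃ λ rest → proj₁ b ≡ as ++ rest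

leafLabels-below : ∀ {t : Tree} {as : List ℕ} {X : List Branch} {l : ℕ} →
  (∀ {b} → (b ∈ branches t × Below as b) ⇔ b ∈ X) →
  (∃ λ (v : Pos t) → Leaf v × Below as (branchAt v) × label v ≡ just l) ⇔ just l ∈ map leafLabel X
leafLabels-below {t} {as} {X} {l} below⇔ = mk⇔ to from
  where
  to : (∃ λ (v : Pos t) → Leaf v × Below as (branchAt v) × label v ≡ just l) → just l ∈ map leafLabel X
  to (v , leaf , below , lab) = subst (_∈ map leafLabel X) (trans (sym (label≡last-pathLabels v)) lab)
    (∈-map⁺ leafLabel (Equivalence.to below⇔ (branchAt∈branches v leaf , below)))
  from : just l ∈ map leafLabel X → ∃ λ (v : Pos t) → Leaf v × Below as (branchAt v) × label v ≡ just l
  from jl∈ with ∈-map⁻ leafLabel jl∈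
  ... | b , b∈X , jl≡ with Equivalence.from below⇔ b∈X
  ...   | b∈ , below with ∈-branches⇒leaf b∈
  ...     | v , leaf , v↦b =
    v , leaf , subst (Below as) (sym v↦b) below ,
    trans (label≡last-pathLabels v) (trans (cong leafLabel v↦b) (sym jl≡))

shiftBranch : ℕ → Branch → Branch
shiftBranch a (bs , ms) = bs , map (_+ a) ms

mutual
  branches-shift : ∀ a t → branches (shift a t) ≡ map (shiftBranch a) (branches t)
  branches-shift a (node []) = refl
  branches-shift a (node (c ∷ cs)) = branchesFrom-shift a 0 (c ∷ cs)

  branchesFrom-shift : ∀ a n cs → branchesFrom n (shiftL a cs) ≡ map (shiftBranch a) (branchesFrom n cs)
  branchesFrom-shift a n [] = refl
  branchesFrom-shift a n ((l , t) ∷ cs) = begin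
    map (extend [ n ] [ l + a ]) (branches (shift a t)) ++ branchesFrom (suc n) (shiftL a cs)
      ≡⟨ cong₂ _++_ first (branchesFrom-shift a (suc n) cs) ⟩
    map (shiftBranch a) (map (extend [ n ] [ l ]) (branches t)) ++ map (shiftBranch a) (branchesFrom (suc n) cs)
      ≡⟨ map-++ (shiftBranch a) (map (extend [ n ] [ l ]) (branches t)) _ ⟨
    map (shiftBranch a) (branchesFrom n ((l , t) ∷ cs)) ∎
    where
    open ≡-Reasoning
    first : map (extend [ n ] [ l + a ]) (branches (shift a t))
            ≡ map (shiftBranch a) (map (extend [ n ] [ l ]) (branches t))
    first = begin
      map (extend [ n ] [ l + a ]) (branches (shift a t))          ≡⟨ cong (map _) (branches-shift a t) ⟩
      map (extend [ n ] [ l + a ]) (map (shiftBranch a) (branches t)) ≡⟨ map-∘ (branches t) ⟨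
      map (shiftBranch a ∘ extend [ n ] [ l ]) (branches t)        ≡⟨ map-∘ (branches t) ⟩
      map (shiftBranch a) (map (extend [ n ] [ l ]) (branches t))  ∎

node-children : ∀ t → node (children t) ≡ t
node-children (node cs) = refl

branches-chain : ∀ ls t →
  branches (node (chain ls (children t))) ≡ map (extend (replicate (length ls) 0) ls) (branches t)
branches-chain [] t = trans (cong branches (node-children t)) (sym (map-id (branches t)))
branches-chain (l ∷ ls) t = begin
  map (extend [ 0 ] [ l ]) (branches (node (chain ls (children t)))) ++ []
    ≡⟨ ++-identityʳ _ ⟩
  map (extend [ 0 ] [ l ]) (branches (node (chain ls (children t))))
    ≡⟨ cong (map (extend [ 0 ] [ l ])) (branches-chain ls t) ⟩
  map (extend [ 0 ] [ l ]) (map (extend (replicate (length ls) 0) ls) (branches t))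
    ≡⟨ map-∘ (branches t) ⟨
  map (extend (replicate (length (l ∷ ls)) 0) (l ∷ ls)) (branches t) ∎
  where open ≡-Reasoning

mutual
  allLabels : Tree → List ℕ
  allLabels (node cs) = forestLabels cs

  forestLabels : List (ℕ × Tree) → List ℕ
  forestLabels [] = []
  forestLabels ((l , t) ∷ cs) = l ∷ allLabels t ++ forestLabels cs

forestLabels-++ : ∀ cs ds → forestLabels (cs ++ ds) ≡ forestLabels cs ++ forestLabels ds
forestLabels-++ [] ds = refl
forestLabels-++ ((l , t) ∷ cs) ds =
  cong (l ∷_) (trans (cong (allLabels t ++_) (forestLabels-++ cs ds)) (sym (++-assoc (allLabels t) _ _)))

forestLabels-chain : ∀ ls cs → forestLabels (chain ls cs) ≡ ls ++ forestLabels cs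
forestLabels-chain [] cs = refl
forestLabels-chain (l ∷ ls) cs = cong (l ∷_) (trans (++-identityʳ _) (forestLabels-chain ls cs))

mutual
  allLabels-shift : ∀ a t → allLabels (shift a t) ≡ map (_+ a) (allLabels t)
  allLabels-shift a (node cs) = forestLabels-shift a cs

  forestLabels-shift : ∀ a cs → forestLabels (shiftL a cs) ≡ map (_+ a) (forestLabels cs)
  forestLabels-shift a [] = refl
  forestLabels-shift a ((l , t) ∷ cs) = cong (l + a ∷_) (begin
    allLabels (shift a t) ++ forestLabels (shiftL a cs)
      ≡⟨ cong₂ _++_ (allLabels-shift a t) (forestLabels-shift a cs) ⟩
    map (_+ a) (allLabels t) ++ map (_+ a) (forestLabels cs)
      ≡⟨ map-++ (_+ a) (allLabels t) _ ⟨
    map (_+ a) (allLabels t ++ forestLabels cs) ∎)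
    where open ≡-Reasoning

split : ∀ {l t cs} → Pos (node ((l , t) ∷ cs)) → Pos t ⊎ Pos (node cs)
split root = inj₂ root
split (child zero p) = inj₁ p
split (child (suc j) q) = inj₂ (child j q)

split-injective : ∀ {l t cs} {v w : Pos (node ((l , t) ∷ cs))} → split v ≡ split w → v ≡ w
split-injective {v = root} {root} _ = refl
split-injective {v = root} {child zero _} ()
split-injective {v = root} {child (suc _) _} ()
split-injective {v = child zero _} {root} ()
split-injective {v = child zero p} {child zero q} e with inj₁-injective e
... | refl = refl
split-injective {v = child zero _} {child (suc _) _} ()
split-injective {v = child (suc _) _} {root} ()
split-injective {v = child (suc _) _} {child zero _} ()
split-injective {v = child (suc i) p} {child (suc j) q} e with inj₂-injective e
... | refl = refl

-- m is the label of the root (nothing for an unlabelled root).  Via split, the vertices of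
-- node ((l , t) ∷ cs) are those of t, rooted at the child labelled l, and those of node cs.
length≤count : ∀ (m : Maybe ℕ) cs {i} (vs : List (Pos (node cs))) → Unique vs →
  All (λ v → label v <∣> m ≡ just i) vs → length vs ≤ count i (fromMaybe m ++ forestLabels cs)
length≤count m [] [] _ _ = z≤n
length≤count m [] {i} (root ∷ []) _ (refl ∷ []) = ≤-reflexive (sym (count-here i []))
length≤count m [] (root ∷ root ∷ _) ((root≢root ∷ _) ∷ _) _ = contradiction refl root≢root
length≤count m ((l , node ds) ∷ cs) {i} vs u lab = begin
  length vs                                 ≡⟨ length-map split vs ⟨
  length zs                                 ≡⟨ length-partitionSums zs ⟩
  length (proj₁ parts) + length (proj₂ parts)
    ≤⟨ +-mono-≤ (length≤count (just l) ds (proj₁ parts) (proj₁ uniq) (proj₁ labs))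
                (length≤count m cs (proj₂ parts) (proj₂ uniq) (proj₂ labs)) ⟩
  count i D + count i (M ++ C)              ≡⟨ cong (count i D +_) (count-++ i M C) ⟩
  count i D + (count i M + count i C)       ≡⟨ x∙yz≈y∙xz (count i D) (count i M) (count i C) ⟩
  count i M + (count i D + count i C)       ≡⟨ cong (count i M +_) (count-++ i D C) ⟨
  count i M + count i (D ++ C)              ≡⟨ count-++ i M (D ++ C) ⟨
  count i (M ++ D ++ C)                     ∎
  where
  open ≤-Reasoning
  M D C : List ℕ
  M = fromMaybe m
  D = l ∷ forestLabels ds
  C = forestLabels cs
  zs : List (Pos (node ds) ⊎ Pos (node cs))
  zs = map split vs
  parts : List (Pos (node ds)) × List (Pos (node cs))
  parts = partitionSums zs
  uniq : Unique (proj₁ parts) × Unique (proj₂ parts)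
  uniq = Unique-partitionSums (Unique.map⁺ split-injective u)
  transport : ∀ {v : Pos (node ((l , node ds) ∷ cs))} → label v <∣> m ≡ just i →
    [ (λ p → label p <∣> just l ≡ just i) , (λ w → label w <∣> m ≡ just i) ]′ (split v)
  transport {root} e = e
  transport {child zero p} e = trans (sym (<∣>-assoc (label p) (just l) m)) e
  transport {child (suc j) q} e = e
  labs : All (λ p → label p <∣> just l ≡ just i) (proj₁ parts)
       × All (λ w → label w <∣> m ≡ just i) (proj₂ parts)
  labs = All-partitionSums (All-map⁺ (All.map (λ {v} → transport {v}) lab))

length≤count-allLabels : ∀ t {i} (vs : List (Pos t)) → Unique vs →
  All (λ v → label v ≡ just i) vs → length vs ≤ count i (allLabels t)
length≤count-allLabels (node cs) vs u lab =
  length≤count nothing cs vs u (All.map (λ {v} e → trans (<∣>-identityʳ (label v)) e) lab)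

-- T′ (suc f) k reduces to assemble ⌈ k /2⌉ ⌊ k /2⌋ (T′ f ⌈ k /2⌉) (T′ f ⌊ k /2⌋) for k ≥ 2:
-- t₂, shifted, becomes B₁ and t₁ becomes B₂.
assemble : ℕ → ℕ → Tree → Tree → Tree
assemble k₁ k₂ t₁ t₂ =
  node (chain (range 0 k₁) (children (shift k₁ t₂)) ++ chain (range k₁ k₂) (children t₁))

-- k₁, k₂ ≥ 1 makes P₁ and P₂ nonempty paths, hence the parameters m₁ = k₁ ∸ 1 and m₂ = k₂ ∸ 1.
module Assembly (m₁ m₂ : ℕ) (t₁ t₂ : Tree) where

  k₁ k₂ : ℕ
  k₁ = suc m₁
  k₂ = suc m₂

  R₁ R₂ : List ℕ
  R₁ = range 0 k₁
  R₂ = range k₁ k₂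

  R₁++R₂ : R₁ ++ R₂ ≡ range 0 (k₁ + k₂)
  R₁++R₂ = range-++ 0 k₁ k₂

  -- the branch of the assembled tree continuing a branch of t₂ below λ₁, resp. of t₁ below λ₂
  throughB₁ throughB₂ : Branch → Branch
  throughB₁ = extend (replicate k₁ 0) R₁ ∘ shiftBranch k₁
  throughB₂ = extend (1 ∷ replicate m₂ 0) R₂

  branches-assemble :
    branches (assemble k₁ k₂ t₁ t₂) ≡ map throughB₁ (branches t₂) ++ map throughB₂ (branches t₁)
  branches-assemble = cong₂ _++_ block₁ (trans (++-identityʳ _) block₂)
    where
    open ≡-Reasoning
    block₁ : map (extend [ 0 ] [ 1 ]) (branches (node (chain (range 1 m₁) (children (shift k₁ t₂)))))
                ≡ map throughB₁ (branches t₂)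
    block₁ = begin
      map (extend [ 0 ] [ 1 ]) (branches (node (chain (range 1 m₁) (children (shift k₁ t₂)))))
        ≡⟨ cong (map (extend [ 0 ] [ 1 ])) (branches-chain (range 1 m₁) (shift k₁ t₂)) ⟩
      map (extend [ 0 ] [ 1 ])
        (map (extend (replicate (length (range 1 m₁)) 0) (range 1 m₁)) (branches (shift k₁ t₂)))
        ≡⟨ map-∘ (branches (shift k₁ t₂)) ⟨
      map (extend (replicate (suc (length (range 1 m₁))) 0) R₁) (branches (shift k₁ t₂))
        ≡⟨ cong₂ (λ n → map (extend (replicate (suc n) 0) R₁)) (length-range 1 m₁) (branches-shift k₁ t₂) ⟩
      map (extend (replicate k₁ 0) R₁) (map (shiftBranch k₁) (branches t₂))
        ≡⟨ map-∘ (branches t₂) ⟨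
      map throughB₁ (branches t₂) ∎
    block₂ : map (extend [ 1 ] [ suc k₁ ]) (branches (node (chain (range (suc k₁) m₂) (children t₁))))
                ≡ map throughB₂ (branches t₁)
    block₂ = begin
      map (extend [ 1 ] [ suc k₁ ]) (branches (node (chain (range (suc k₁) m₂) (children t₁))))
        ≡⟨ cong (map (extend [ 1 ] [ suc k₁ ])) (branches-chain (range (suc k₁) m₂) t₁) ⟩
      map (extend [ 1 ] [ suc k₁ ])
        (map (extend (replicate (length (range (suc k₁) m₂)) 0) (range (suc k₁) m₂)) (branches t₁))
        ≡⟨ map-∘ (branches t₁) ⟨
      map (extend (1 ∷ replicate (length (range (suc k₁) m₂)) 0) R₂) (branches t₁)
        ≡⟨ cong (λ n → map (extend (1 ∷ replicate n 0) R₂) (branches t₁)) (length-range (suc k₁) m₂) ⟩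
      map throughB₂ (branches t₁) ∎

  pathLabels-assemble :
    All (λ b → proj₂ b ∼[ set ] R₁) (branches t₁) →
    All (λ b → proj₂ b ∼[ set ] range 0 k₂) (branches t₂) →
    All (λ b → proj₂ b ∼[ set ] range 0 (k₁ + k₂)) (branches (assemble k₁ k₂ t₁ t₂))
  pathLabels-assemble h₁ h₂ = subst (All _) (sym branches-assemble)
    (++⁺ (All-map⁺ (All.map (λ {b} → throughB₁-complete {b}) h₂))
         (All-map⁺ (All.map (λ {b} → throughB₂-complete {b}) h₁)))
    where
    open ∼-Reasoning
    throughB₁-complete : ∀ {b} → proj₂ b ∼[ set ] range 0 k₂ → proj₂ (throughB₁ b) ∼[ set ] range 0 (k₁ + k₂)
    throughB₁-complete {_ , ls} ls∼ = begin
      R₁ ++ map (_+ k₁) ls           ≈⟨ ++-cong ∼.refl (map-cong (λ _ → refl) ls∼) ⟩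
      R₁ ++ map (_+ k₁) (range 0 k₂) ≡⟨ cong (R₁ ++_) (map-+-range k₁ 0 k₂) ⟩
      R₁ ++ R₂              ≡⟨ R₁++R₂ ⟩
      range 0 (k₁ + k₂)                      ∎
    throughB₂-complete : ∀ {b} → proj₂ b ∼[ set ] R₁ → proj₂ (throughB₂ b) ∼[ set ] range 0 (k₁ + k₂)
    throughB₂-complete {_ , ls} ls∼ = begin
      R₂ ++ ls         ≈⟨ ++-cong ∼.refl ls∼ ⟩
      R₂ ++ R₁ ≈⟨ ++-comm-∼ R₂ R₁ ⟩
      R₁ ++ R₂ ≡⟨ R₁++R₂ ⟩
      range 0 (k₁ + k₂)         ∎

  leafLabels-throughB₁ : map leafLabel (branches t₂) ∼[ set ] map just (range 0 k₂) →
    map leafLabel (map throughB₁ (branches t₂)) ∼[ set ] map just R₂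
  leafLabels-throughB₁ h₂ = begin
    map leafLabel (map throughB₁ (branches t₂)) ≡⟨ map-∘ (branches t₂) ⟨
    map (leafLabel ∘ throughB₁) (branches t₂)   ≡⟨ List.map-cong leafLabel-throughB₁ (branches t₂) ⟩
    map (g ∘ leafLabel) (branches t₂)       ≡⟨ map-∘ (branches t₂) ⟩
    map g (map leafLabel (branches t₂))     ≈⟨ map-cong (λ _ → refl) h₂ ⟩
    map g (map just (range 0 k₂))           ≡⟨ map-∘ (range 0 k₂) ⟨
    map (just ∘ (_+ k₁)) (range 0 k₂)       ≡⟨ map-∘ (range 0 k₂) ⟩
    map just (map (_+ k₁) (range 0 k₂))     ≡⟨ cong (map just) (map-+-range k₁ 0 k₂) ⟩
    map just R₂                  ∎
    where
    open ∼-Reasoning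
    g : Maybe ℕ → Maybe ℕ
    g m = Maybe.map (_+ k₁) m <∣> last R₁
    leafLabel-throughB₁ : ∀ b → leafLabel (throughB₁ b) ≡ g (leafLabel b)
    leafLabel-throughB₁ (_ , ls) =
      trans (last-++ R₁ (map (_+ k₁) ls)) (cong (_<∣> last R₁) (last-map (_+ k₁) ls))

  leafLabels-throughB₂ : map leafLabel (branches t₁) ∼[ set ] map just R₁ →
    map leafLabel (map throughB₂ (branches t₁)) ∼[ set ] map just R₁
  leafLabels-throughB₂ h₁ = begin
    map leafLabel (map throughB₂ (branches t₁)) ≡⟨ map-∘ (branches t₁) ⟨
    map (leafLabel ∘ throughB₂) (branches t₁)   ≡⟨ List.map-cong (λ b → last-++ R₂ (proj₂ b)) (branches t₁) ⟩
    map (g ∘ leafLabel) (branches t₁)       ≡⟨ map-∘ (branches t₁) ⟩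
    map g (map leafLabel (branches t₁))     ≈⟨ map-cong (λ _ → refl) h₁ ⟩
    map g (map just R₁)           ≡⟨ map-∘ R₁ ⟨
    map just R₁                   ∎
    where
    open ∼-Reasoning
    g : Maybe ℕ → Maybe ℕ
    g m = m <∣> last R₂

  leafLabels-assemble :
    map leafLabel (branches t₁) ∼[ set ] map just R₁ →
    map leafLabel (branches t₂) ∼[ set ] map just (range 0 k₂) →
    map leafLabel (branches (assemble k₁ k₂ t₁ t₂)) ∼[ set ] map just (range 0 (k₁ + k₂))
  leafLabels-assemble h₁ h₂ = begin
    map leafLabel (branches (assemble k₁ k₂ t₁ t₂))
      ≡⟨ cong (map leafLabel) branches-assemble ⟩
    map leafLabel (map throughB₁ (branches t₂) ++ map throughB₂ (branches t₁))
      ≡⟨ map-++ leafLabel (map throughB₁ (branches t₂)) _ ⟩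
    map leafLabel (map throughB₁ (branches t₂)) ++ map leafLabel (map throughB₂ (branches t₁))
      ≈⟨ ++-cong (leafLabels-throughB₁ h₂) (leafLabels-throughB₂ h₁) ⟩
    map just R₂ ++ map just R₁
      ≈⟨ ++-comm-∼ (map just R₂) _ ⟩
    map just R₁ ++ map just R₂
      ≡⟨ map-++ just R₁ _ ⟨
    map just (R₁ ++ R₂)
      ≡⟨ cong (map just) (R₁++R₂) ⟩
    map just (range 0 (k₁ + k₂)) ∎
    where open ∼-Reasoning

  below-λ₁⇔ : ∀ {b} →
    (b ∈ branches (assemble k₁ k₂ t₁ t₂) × Below (replicate k₁ 0) b) ⇔ b ∈ map throughB₁ (branches t₂)
  below-λ₁⇔ = mk⇔ to from
    where
    to : ∀ {b} → b ∈ branches (assemble k₁ k₂ t₁ t₂) × Below (replicate k₁ 0) b →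
      b ∈ map throughB₁ (branches t₂)
    to (b∈ , _ , e) with ∈-++⁻ (map throughB₁ (branches t₂)) (subst (_ ∈_) branches-assemble b∈)
    ... | inj₁ b∈₁ = b∈₁
    ... | inj₂ b∈₂ with ∈-map⁻ throughB₂ b∈₂
    ...   | _ , _ , refl = contradiction (∷-injectiveˡ e) λ ()
    from : ∀ {b} → b ∈ map throughB₁ (branches t₂) →
      b ∈ branches (assemble k₁ k₂ t₁ t₂) × Below (replicate k₁ 0) b
    from b∈₁ with ∈-map⁻ throughB₁ b∈₁
    ... | b′ , _ , refl = subst (_ ∈_) (sym branches-assemble) (∈-++⁺ˡ b∈₁) , proj₁ b′ , refl

  below-λ₂⇔ : ∀ {b} →
    (b ∈ branches (assemble k₁ k₂ t₁ t₂) × Below (1 ∷ replicate m₂ 0) b) ⇔ b ∈ map throughB₂ (branches t₁)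
  below-λ₂⇔ = mk⇔ to from
    where
    to : ∀ {b} → b ∈ branches (assemble k₁ k₂ t₁ t₂) × Below (1 ∷ replicate m₂ 0) b →
      b ∈ map throughB₂ (branches t₁)
    to (b∈ , _ , e) with ∈-++⁻ (map throughB₁ (branches t₂)) (subst (_ ∈_) branches-assemble b∈)
    ... | inj₂ b∈₂ = b∈₂
    ... | inj₁ b∈₁ with ∈-map⁻ throughB₁ b∈₁
    ...   | _ , _ , refl = contradiction (∷-injectiveˡ e) λ ()
    from : ∀ {b} → b ∈ map throughB₂ (branches t₁) →
      b ∈ branches (assemble k₁ k₂ t₁ t₂) × Below (1 ∷ replicate m₂ 0) b
    from b∈₂ with ∈-map⁻ throughB₂ b∈₂
    ... | b′ , _ , refl =
      subst (_ ∈_) (sym branches-assemble) (∈-++⁺ʳ (map throughB₁ (branches t₂)) b∈₂) , proj₁ b′ , refl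

  allLabels-assemble : allLabels (assemble k₁ k₂ t₁ t₂)
                       ≡ (R₁ ++ map (_+ k₁) (allLabels t₂)) ++ (R₂ ++ allLabels t₁)
  allLabels-assemble = begin
    forestLabels (chain R₁ (children (shift k₁ t₂)) ++ chain R₂ (children t₁))
      ≡⟨ forestLabels-++ (chain R₁ (children (shift k₁ t₂))) (chain R₂ (children t₁)) ⟩
    forestLabels (chain R₁ (children (shift k₁ t₂))) ++ forestLabels (chain R₂ (children t₁))
      ≡⟨ cong₂ _++_ (forestLabels-chain R₁ _) (forestLabels-chain R₂ _) ⟩
    (R₁ ++ allLabels (node (children (shift k₁ t₂)))) ++ (R₂ ++ allLabels (node (children t₁)))
      ≡⟨ cong₂ (λ xs ys → (R₁ ++ xs) ++ (R₂ ++ ys))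
               (trans (cong allLabels (node-children (shift k₁ t₂))) (allLabels-shift k₁ t₂))
               (cong allLabels (node-children t₁)) ⟩
    (R₁ ++ map (_+ k₁) (allLabels t₂)) ++ (R₂ ++ allLabels t₁) ∎
    where open ≡-Reasoning

  shifted-⊆ : allLabels t₂ ⊆ range 0 k₂ → map (_+ k₁) (allLabels t₂) ⊆ R₂
  shifted-⊆ h₂ = subst (map (_+ k₁) (allLabels t₂) ⊆_) (map-+-range k₁ 0 k₂) (⊆.map⁺ (_+ k₁) h₂)

  allLabels-assemble⊆range : allLabels t₁ ⊆ R₁ → allLabels t₂ ⊆ range 0 k₂ →
    allLabels (assemble k₁ k₂ t₁ t₂) ⊆ range 0 (k₁ + k₂)
  allLabels-assemble⊆range h₁ h₂ {x} x∈ = Equivalence.to collapse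
    (⊆.++⁺ (⊆.++⁺ʳ R₁ (shifted-⊆ h₂)) (⊆.++⁺ʳ R₂ h₁) (subst (x ∈_) allLabels-assemble x∈))
    where
    open ∼-Reasoning
    collapse : (R₁ ++ R₂) ++ (R₂ ++ R₁) ∼[ set ] range 0 (k₁ + k₂)
    collapse = begin
      (R₁ ++ R₂) ++ (R₂ ++ R₁)
        ≈⟨ ++-cong (∼.refl {x = R₁ ++ R₂}) (++-comm-∼ R₂ R₁) ⟩
      (R₁ ++ R₂) ++ (R₁ ++ R₂)
        ≈⟨ ++-idempotent (R₁ ++ R₂) ⟩
      R₁ ++ R₂
        ≡⟨ R₁++R₂ ⟩
      range 0 (k₁ + k₂) ∎

  -- A label occurs at most once along P₁ and P₂, and in at most one of B₁ and B₂.
  count-assemble : ∀ {B} → allLabels t₁ ⊆ R₁ → allLabels t₂ ⊆ range 0 k₂ →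
    (∀ i → count i (allLabels t₁) ≤ B) → (∀ i → count i (allLabels t₂) ≤ B) →
    ∀ i → count i (allLabels (assemble k₁ k₂ t₁ t₂)) ≤ suc B
  count-assemble {B} h₁ h₂ c₁ c₂ i = begin
    count i (allLabels (assemble k₁ k₂ t₁ t₂))           ≡⟨ cong (count i) allLabels-assemble ⟩
    count i ((R₁ ++ S) ++ (R₂ ++ L))                      ≡⟨ count-++ i (R₁ ++ S) (R₂ ++ L) ⟩
    count i (R₁ ++ S) + count i (R₂ ++ L)                 ≡⟨ cong₂ _+_ (count-++ i R₁ S) (count-++ i R₂ L) ⟩
    (count i R₁ + count i S) + (count i R₂ + count i L)   ≡⟨ interchange (count i R₁) (count i S) _ _ ⟩
    (count i R₁ + count i R₂) + (count i S + count i L)   ≡⟨ cong (_+ (count i S + count i L)) (count-++ i R₁ R₂) ⟨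
    count i (R₁ ++ R₂) + (count i S + count i L)          ≤⟨ +-mono-≤ pathsOnce subtreesOnce ⟩
    suc B                                                 ∎
    where
    open ≤-Reasoning
    S L : List ℕ
    S = map (_+ k₁) (allLabels t₂)
    L = allLabels t₁
    pathsOnce : count i (R₁ ++ R₂) ≤ 1
    pathsOnce = count-unique i (subst Unique (sym (R₁++R₂)) (range-unique 0 (k₁ + k₂)))
    subtreesOnce : count i S + count i L ≤ B
    subtreesOnce with i ≤? k₁
    ... | yes i≤k₁ = subst (λ c → c + count i L ≤ B) (sym (∉⇒count≡0 i∉S)) (c₁ i)
      where
      i∉S : i ∉ S
      i∉S i∈S = <⇒≱ (proj₁ (Equivalence.to (∈-range⇔ k₁ k₂) (shifted-⊆ h₂ i∈S))) i≤k₁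
    ... | no i≰k₁ = subst₂ (λ c c′ → c + c′ ≤ B) (sym S-count) (sym (∉⇒count≡0 i∉L))
                      (≤-trans (≤-reflexive (+-identityʳ _)) (c₂ (i ∸ k₁)))
      where
      i∉L : i ∉ L
      i∉L i∈L = i≰k₁ (proj₂ (Equivalence.to (∈-range⇔ 0 k₁) (h₁ i∈L)))
      S-count : count i S ≡ count (i ∸ k₁) (allLabels t₂)
      S-count = trans (cong (λ j → count j S) (sym (m∸n+n≡m (<⇒≤ (≰⇒> i≰k₁)))))
                      (count-map-+ k₁ (i ∸ k₁) (allLabels t₂))

halves-sum : ∀ n → ⌈ 2 + n /2⌉ + ⌊ 2 + n /2⌋ ≡ 2 + n
halves-sum n = trans (+-comm ⌈ 2 + n /2⌉ _) (⌊n/2⌋+⌈n/2⌉≡n (2 + n))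

⌊2+n/2⌋<2+n : ∀ n → ⌊ 2 + n /2⌋ < 2 + n
⌊2+n/2⌋<2+n n = ≤-<-trans (⌊n/2⌋≤⌈n/2⌉ (2 + n)) (⌈n/2⌉<n n)

T′-fuel : ∀ {f g k} → k ≤ f → k ≤ g → T′ f k ≡ T′ g k
T′-fuel {zero} {zero} {zero} _ _ = refl
T′-fuel {zero} {suc g} {zero} _ _ = refl
T′-fuel {suc f} {zero} {zero} _ _ = refl
T′-fuel {suc f} {suc g} {zero} _ _ = refl
T′-fuel {suc f} {suc g} {suc zero} _ _ = refl
T′-fuel {suc f} {suc g} {suc (suc n)} (s≤s 1+n≤f) (s≤s 1+n≤g) =
  cong₂ (assemble ⌈ 2 + n /2⌉ ⌊ 2 + n /2⌋)
    (T′-fuel (≤-trans ⌈2+n/2⌉≤1+n 1+n≤f) (≤-trans ⌈2+n/2⌉≤1+n 1+n≤g))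
    (T′-fuel (≤-trans (s≤s⁻¹ (⌊2+n/2⌋<2+n n)) 1+n≤f) (≤-trans (s≤s⁻¹ (⌊2+n/2⌋<2+n n)) 1+n≤g))
  where
  ⌈2+n/2⌉≤1+n : ⌈ 2 + n /2⌉ ≤ suc n
  ⌈2+n/2⌉≤1+n = s≤s⁻¹ (⌈n/2⌉<n n)

T-unfold : ∀ n → T (2 + n) ≡ assemble ⌈ 2 + n /2⌉ ⌊ 2 + n /2⌋ (T ⌈ 2 + n /2⌉) (T ⌊ 2 + n /2⌋)
T-unfold n = cong₂ (assemble ⌈ 2 + n /2⌉ ⌊ 2 + n /2⌋)
  (T′-fuel (s≤s⁻¹ (⌈n/2⌉<n n)) ≤-refl) (T′-fuel (s≤s⁻¹ (⌊2+n/2⌋<2+n n)) ≤-refl)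

halving-induction : (P : ℕ → Set) → P 1 → (∀ n → P ⌈ 2 + n /2⌉ → P ⌊ 2 + n /2⌋ → P (2 + n)) →
  ∀ k → 1 ≤ k → P k
halving-induction P base step = <-rec (λ k → 1 ≤ k → P k) go
  where
  go : ∀ k → (∀ {j} → j < k → 1 ≤ j → P j) → 1 ≤ k → P k
  go (suc zero) _ _ = base
  go (suc (suc n)) rec _ = step n (rec (⌈n/2⌉<n n) (s≤s z≤n)) (rec (⌊2+n/2⌋<2+n n) (s≤s z≤n))

-- Assembly's k₁ and k₂ are here ⌈ 2 + n /2⌉ and ⌊ 2 + n /2⌋ definitionally.
module Halves (n : ℕ) = Assembly ⌊ suc n /2⌋ ⌊ n /2⌋ (T ⌈ 2 + n /2⌉) (T ⌊ 2 + n /2⌋)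

T-pathLabels∼range : ∀ k → 1 ≤ k → All (λ b → proj₂ b ∼[ set ] range 0 k) (branches (T k))
T-pathLabels∼range = halving-induction _ (∼.refl ∷ []) λ n h₁ h₂ →
  subst₂ (λ k t → All (λ b → proj₂ b ∼[ set ] range 0 k) (branches t)) (halves-sum n) (sym (T-unfold n))
    (Halves.pathLabels-assemble n h₁ h₂)

T-leafLabels∼range : ∀ k → 1 ≤ k → map leafLabel (branches (T k)) ∼[ set ] map just (range 0 k)
T-leafLabels∼range = halving-induction _ ∼.refl λ n h₁ h₂ →
  subst₂ (λ k t → map leafLabel (branches t) ∼[ set ] map just (range 0 k)) (halves-sum n) (sym (T-unfold n))
    (Halves.leafLabels-assemble n h₁ h₂)

T-allLabels⊆range : ∀ k → 1 ≤ k → allLabels (T k) ⊆ range 0 k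
T-allLabels⊆range = halving-induction _ (λ x∈ → x∈) λ n h₁ h₂ →
  subst₂ (λ k t → allLabels t ⊆ range 0 k) (halves-sum n) (sym (T-unfold n))
    (Halves.allLabels-assemble⊆range n h₁ h₂)

log-halving : ∀ n → ⌈log₂ ⌈ 2 + n /2⌉ ⌉ + 1 ≡ ⌈log₂ (2 + n) ⌉
log-halving n =
  trans (cong (_+ 1) (⌈log₂⌈n/2⌉⌉≡⌈log₂n⌉∸1 (2 + n))) (m∸n+n≡m (⌈log₂⌉-mono-≤ {2} {2 + n} (s≤s (s≤s z≤n))))

T-count≤log : ∀ k → 1 ≤ k → ∀ i → count i (allLabels (T k)) ≤ ⌈log₂ k ⌉ + 1
T-count≤log = halving-induction _ (λ i → count-unique i (range-unique 0 1)) λ n c₁ c₂ i →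
  subst₂ (λ t b → count i (allLabels t) ≤ b) (sym (T-unfold n)) (bound-eq n)
    (Halves.count-assemble n (T-allLabels⊆range _ (s≤s z≤n)) (T-allLabels⊆range _ (s≤s z≤n))
      c₁ (λ j → ≤-trans (c₂ j) (+-monoˡ-≤ 1 (⌈log₂⌉-mono-≤ (⌊n/2⌋≤⌈n/2⌉ (2 + n))))) i)
  where
  bound-eq : ∀ n → suc (⌈log₂ ⌈ 2 + n /2⌉ ⌉ + 1) ≡ ⌈log₂ (2 + n) ⌉ + 1
  bound-eq n = trans (cong suc (log-halving n)) (+-comm 1 _)

T-leafLabels-B₁-B₂ : ∀ k → 2 ≤ k →
  ((l : ℕ) → (∃ λ (v : Pos (T k)) → Leaf v × InB₁ k v × label v ≡ just l) ⇔ (⌈ k /2⌉ + 1 ≤ l × l ≤ k))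
  × ((l : ℕ) → (∃ λ (v : Pos (T k)) → Leaf v × InB₂ k v × label v ≡ just l) ⇔ (1 ≤ l × l ≤ ⌈ k /2⌉))
T-leafLabels-B₁-B₂ (suc zero) (s≤s ())
T-leafLabels-B₁-B₂ (suc (suc n)) _ =
    (λ l → ⇔-trans (below below-λ₁⇔) (⇔-trans (leafLabels-B₁ l) (bounds-B₁ l)))
  , (λ l → ⇔-trans (below below-λ₂⇔) (leafLabels-B₂ l))
  where
  open Halves n
  below : ∀ {as X l} → (∀ {b} → (b ∈ branches (assemble k₁ k₂ (T k₁) (T k₂)) × Below as b) ⇔ b ∈ X) →
    (∃ λ (v : Pos (T (2 + n))) → Leaf v × Below as (branchAt v) × label v ≡ just l) ⇔ just l ∈ map leafLabel X
  below {as} {X} below⇔ =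
    leafLabels-below (λ {b} → subst (λ t → (b ∈ branches t × Below as b) ⇔ b ∈ X) (sym (T-unfold n)) below⇔)
  leafLabels-B₁ : ∀ l → just l ∈ map leafLabel (map throughB₁ (branches (T k₂))) ⇔ l ∈ R₂
  leafLabels-B₁ l = ⇔-trans (leafLabels-throughB₁ (T-leafLabels∼range k₂ (s≤s z≤n))) just∈map-just⇔
  leafLabels-B₂ : ∀ l → just l ∈ map leafLabel (map throughB₂ (branches (T k₁))) ⇔ (1 ≤ l × l ≤ k₁)
  leafLabels-B₂ l =
    ⇔-trans (leafLabels-throughB₂ (T-leafLabels∼range k₁ (s≤s z≤n))) (⇔-trans just∈map-just⇔ (∈-range⇔ 0 k₁))
  bounds-B₁ : ∀ l → l ∈ R₂ ⇔ (k₁ + 1 ≤ l × l ≤ 2 + n)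
  bounds-B₁ l = subst₂ (λ a c → l ∈ R₂ ⇔ (a ≤ l × l ≤ c)) (+-comm 1 k₁) (halves-sum n) (∈-range⇔ k₁ k₂)

T-ancestorLabels⇔range : ∀ k → 1 ≤ k → (λ′ : Pos (T k)) → Leaf λ′ → (l : ℕ) →
  (∃ λ (q : Pos (T k)) → q ≼ λ′ × label q ≡ just l) ⇔ (1 ≤ l × l ≤ k)
T-ancestorLabels⇔range k 1≤k v leaf l =
  ⇔-trans (ancestorLabel⇔∈pathLabels v)
    (⇔-trans (All.lookup (T-pathLabels∼range k 1≤k) (branchAt∈branches v leaf)) (∈-range⇔ 0 k))

lemma7 : (k : ℕ) → 1 ≤ k →
    (2 ≤ k →
      ((l : ℕ) → (∃ λ (v : Pos (T k)) → Leaf v × InB₁ k v × label v ≡ just l)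
                   ⇔ (⌈ k /2⌉ + 1 ≤ l × l ≤ k))
      × ((l : ℕ) → (∃ λ (v : Pos (T k)) → Leaf v × InB₂ k v × label v ≡ just l)
                   ⇔ (1 ≤ l × l ≤ ⌈ k /2⌉)))
    × ((λ′ : Pos (T k)) → Leaf λ′ → (l : ℕ) →
        (∃ λ (q : Pos (T k)) → q ≼ λ′ × label q ≡ just l) ⇔ (1 ≤ l × l ≤ k))
    × ((i : ℕ) → 1 ≤ i → i ≤ k → (vs : List (Pos (T k))) → Unique vs →
        All (λ v → label v ≡ just i) vs → length vs ≤ ⌈log₂ k ⌉ + 1)
lemma7 k 1≤k =
    T-leafLabels-B₁-B₂ k
  , T-ancestorLabels⇔range k 1≤k
  -- the bound holds for every label
  , λ i _ _ vs unique labelled →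
      ≤-trans (length≤count-allLabels (T k) vs unique labelled) (T-count≤log k 1≤k i)
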